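{- Let $M$ be a rank-$4$ simple matroid with ground set $\{x_1,x_2,\dots,x_9\}$ such that $\{x_1,x_2,x_3\}$, $\{x_4,x_5,x_6\}$, $\{x_7,x_8,x_9\}$, $\{x_1,x_4,x_7\}$, and $\{x_3,x_6,x_9\}$ are triangles of $M$. Then $M\cong M^*(K_{3,3})$, or $M$ has $U_{2,5}$ or $P_7$ as a minor.
   Context: A triangle is a 3-element circuit. $M^*(K_{3,3})$ is the bond matroid of $K_{3,3}$. $P_7$ is the rank-3 matroid on $\{a,b,c,d,e,f,g\}$ whose lines with more than two points are exactly the 3-point lines $\{a,b,c\},\{a,e,d\},\{c,g,d\},\{b,f,d\},\{e,f,g\}$. -}

module Defs where

open import Data.Nat using (ℕ; zero; suc; _≤_; _<_)
open import Data.Bool using (Bool; true; false; _∧_; _∨_; _xor_)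
open import Data.Fin using (Fin; zero; suc; remQuot; _≟_)
open import Data.Fin.Subset using (Subset; _∈_; _∉_; _⊆_; _⊂_; _∪_; ⁅_⁆; ∣_∣; ⊥; Nonempty)
open import Data.Fin.Permutation using (Permutation; _⟨$⟩ʳ_)
open import Data.Vec using (tabulate; lookup)
open import Data.Sum using () renaming (_⊎_ to _⊎'_)
open import Data.Product using (Σ; ∃; ∃-syntax; _×_; _,_)
open import Function.Bundles using (_⇔_)
open import Function.Definitions using (Injective)
open import Relation.Binary.PropositionalEquality using (_≡_)
open import Relation.Nullary using (¬_; Dec; does)
open import Relation.Unary using (Decidable)

record Matroid (n : ℕ) : Set₁ where
  field
    Indep      : Subset n → Set
    Indep-dec  : Decidable Indep
    I1 : Indep ⊥
    I2 : ∀ {X Y} → Y ⊆ X → Indep X → Indep Y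
    I3 : ∀ {X Y} → Indep X → Indep Y → ∣ X ∣ < ∣ Y ∣ →
         ∃[ e ] (e ∈ Y × e ∉ X × Indep (X ∪ ⁅ e ⁆))

open Matroid public

module _ {n : ℕ} (M : Matroid n) where

  Dependent : Subset n → Set
  Dependent X = ¬ Indep M X

  Circuit : Subset n → Set
  Circuit C = Dependent C × (∀ Y → Y ⊂ C → Indep M Y)

  Triangle : Subset n → Set
  Triangle C = Circuit C × ∣ C ∣ ≡ 3

  Simple : Set
  Simple = ∀ C → Circuit C → 3 ≤ ∣ C ∣

  HasRank : ℕ → Set
  HasRank r = (∃[ X ] (Indep M X × ∣ X ∣ ≡ r)) × (∀ X → Indep M X → ∣ X ∣ ≤ r)

anyFin : ∀ {k} → (Fin k → Bool) → Bool
anyFin {zero}  p = false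
anyFin {suc k} p = p zero ∨ anyFin (λ i → p (suc i))

image : ∀ {k n} → (Fin k → Fin n) → Subset k → Subset n
image f X = tabulate (λ e → anyFin (λ i → lookup X i ∧ does (f i ≟ e)))

triple : ∀ {n} → Fin n → Fin n → Fin n → Subset n
triple a b c = ⁅ a ⁆ ∪ (⁅ b ⁆ ∪ ⁅ c ⁆)

_≅_ : ∀ {n m} → Matroid n → (Subset m → Set) → Set
_≅_ {n} {m} M N =
  Σ (Permutation n m) λ π → ∀ X → Indep M X ⇔ N (image (π ⟨$⟩ʳ_) X)

-- N (on Fin k, given by its independent sets) is isomorphic to a minor
-- M / C \ D of M.  The ground set of the minor is the image of the
-- injection f; C is the contracted set (disjoint from it), D is the rest.
-- Independent sets of M / C are the sets I ⊆ E - C with I ∪ B independent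
-- in M, where B is any basis (maximal independent subset) of C.
HasMinor : ∀ {n k} → Matroid n → (Subset k → Set) → Set
HasMinor {n} {k} M N =
  Σ (Fin k → Fin n) λ f → Injective _≡_ _≡_ f ×
  Σ (Subset n) λ C → (∀ i → f i ∉ C) ×
  Σ (Subset n) λ B → B ⊆ C × Indep M B ×
    (∀ e → e ∈ C → e ∉ B → ¬ Indep M (B ∪ ⁅ e ⁆)) ×
    (∀ X → N X ⇔ Indep M (image f X ∪ B))

U25-Indep : Subset 5 → Set
U25-Indep X = ∣ X ∣ ≤ 2

module P7 where
  a b c d e f g : Fin 7
  a = zero
  b = suc zero
  c = suc (suc zero)
  d = suc (suc (suc zero))
  e = suc (suc (suc (suc zero)))
  f = suc (suc (suc (suc (suc zero))))
  g = suc (suc (suc (suc (suc (suc zero)))))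

  IsLine : Subset 7 → Set
  IsLine X = (X ≡ triple a b c) ⊎' ((X ≡ triple a e d) ⊎' ((X ≡ triple c g d)
             ⊎' ((X ≡ triple b f d) ⊎' (X ≡ triple e f g))))

P7-Indep : Subset 7 → Set
P7-Indep X = ∣ X ∣ ≤ 3 × ¬ P7.IsLine X

-- Vertices: two sides, each Fin 3.  Edge (i , j) (i on the left, j on
-- the right) is the element combine i j of Fin 9, i.e. remQuot 3 e = (i , j).
-- A vertex set S is given by (A , B) with A ⊆ left, B ⊆ right; the edge cut
-- δ(S) consists of the edges with exactly one end in S.
-- A bond is a minimal nonempty edge cut; the circuits of M*(K_{3,3}) are the
-- bonds, so its independent sets are the edge sets containing no bond.

edgeCut : Subset 3 → Subset 3 → Subset 9
edgeCut A B = tabulate (λ ed → cutAt (remQuot 3 ed))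
  where
    cutAt : Fin 3 × Fin 3 → Bool
    cutAt (i , j) = lookup A i xor lookup B j

IsEdgeCut : Subset 9 → Set
IsEdgeCut X = ∃[ A ] ∃[ B ] (X ≡ edgeCut A B)

IsBond : Subset 9 → Set
IsBond X = IsEdgeCut X × Nonempty X ×
           (∀ Y → IsEdgeCut Y → Nonempty Y → Y ⊆ X → X ⊆ Y)

K33-bond-Indep : Subset 9 → Set
K33-bond-Indep X = ¬ (∃[ Y ] (IsBond Y × Y ⊆ X))

x₁ x₂ x₃ x₄ x₅ x₆ x₇ x₈ x₉ : Fin 9
x₁ = zero
x₂ = suc zero
x₃ = suc (suc zero)
x₄ = suc (suc (suc zero))
x₅ = suc (suc (suc (suc zero)))
x₆ = suc (suc (suc (suc (suc zero))))
x₇ = suc (suc (suc (suc (suc (suc zero)))))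
x₈ = suc (suc (suc (suc (suc (suc (suc zero))))))
x₉ = suc (suc (suc (suc (suc (suc (suc (suc zero)))))))

{-# OPTIONS --safe #-}
-- M is determined by which of the 512 subsets of its ground set are independent, so the
-- lemma can be settled by a tableau argument that uses nothing but the independence axioms.
-- Start from the facts forced by the hypotheses: sets of size at most 2 are independent
-- (simplicity), sets of size more than 4 are dependent (rank), and the five triangles are
-- dependent.  Each branch then derives new facts with (I2) and the exchange axiom (I3), splits
-- on whether a set is independent, or extends an independent set of size less than 4 by the
-- element that (I3) against a basis provides.  Every branch ends in a contradiction or with
-- enough facts to read off either M = M*(K₃,₃) on the identity labelling, or P₇ or U₂,₅ as a
-- restriction of M/x₂, M/x₅, M/x₈ or M/{x₂,x₅}.  The first split is on {x₁,x₂,x₄,x₅}, whose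
-- dependence is refuted outright.
module Submission where

open import Defs
import Agda.Builtin.FromNat as FromNat
open FromNat using (Number)
open import Data.Bool using (Bool; true; false; not; _∧_; if_then_else_)
open import Data.Bool.Properties using (∧-identityʳ; ∧-zeroʳ; ∨-identityʳ) renaming (_≟_ to _≟ᵇ_)
open import Data.Empty using (⊥-elim) renaming (⊥ to Empty)
open import Data.Fin using (Fin; zero; suc; _≟_)
open import Data.Fin.Properties using (all?)
open import Data.Fin.Permutation as Perm using ()
open import Data.Fin.Subset
  using (Subset; outside; inside; _∈_; _∉_; _⊆_; _⊂_; _∪_; ⁅_⁆; ∣_∣; Nonempty) renaming (⊥ to ∅)
open import Data.Fin.Subset.Properties
  using (_∈?_; _⊆?_; _⊂?_; nonempty?; anySubset?; ⊆-refl; ⊆-trans; p⊂q⇒p⊆q; q⊆p∪q; p⊆q⇒∣p∣≤∣q∣)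
open import Data.Fin.Subset.Induction using (⊂-wellFounded)
open import Data.List using (List; []; _∷_)
open import Data.List.Relation.Unary.All as All using (All)
open import Data.List.Relation.Unary.Any using (any?)
open import Data.Maybe using (Maybe; just; nothing)
import Data.Maybe.Properties as Maybe
open import Data.Nat using (ℕ; zero; suc; _≤_; _<_; _≤?_; _<?_; _≡ᵇ_; _%_; _/_)
open import Data.Nat.Properties using (≤-trans; <⇒≱; n≮n)
open import Data.Product using (∃-syntax; _×_; _,_; proj₁; uncurry)
open import Data.Sum using (_⊎_; inj₁; inj₂)
open import Data.Unit using (⊤)
open import Data.Vec using (Vec; []; _∷_; lookup)
import Data.Vec.Properties as Vec
open import Function using (_∘_; const)
open import Function.Bundles using (_⇔_; mk⇔; Equivalence)
open import Function.Definitions using (Injective)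
open import Function.Construct.Composition using (_⇔-∘_)
open import Function.Construct.Symmetry using (⇔-sym)
open import Induction.WellFounded using (Acc; acc)
open import Relation.Binary.PropositionalEquality using (_≡_; _≢_; refl; sym; trans; cong; subst)
open import Relation.Nullary using (¬_; Dec; yes; no; does)
open import Relation.Nullary.Decidable
  using (map′; ¬?; _×-dec_; _⊎-dec_; _→-dec_; decidable-stable; dec-false; from-yes)
open import Relation.Unary using (Pred; Decidable)

private variable
  n k : ℕ

_≟ₛ_ : (X Y : Subset n) → Dec (X ≡ Y)
_≟ₛ_ = Vec.≡-dec _≟ᵇ_

∀-subset? : ∀ {ℓ} {P : Pred (Subset n) ℓ} → Decidable P → Dec (∀ X → P X)
∀-subset? P? = map′ (λ ∄¬P X → decidable-stable (P? X) (λ ¬PX → ∄¬P (X , ¬PX)))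
                    (λ ∀P (X , ¬PX) → ¬PX (∀P X))
                    (¬? (anySubset? (¬? ∘ P?)))

injective? : (f : Fin k → Fin n) → Dec (Injective _≡_ _≡_ f)
injective? f = map′ (λ inj {x} {y} → inj x y) (λ inj x y → inj)
                    (all? λ x → all? λ y → (f x ≟ f y) →-dec (x ≟ y))

⊂⇒⊉ : ∀ {X Y : Subset n} → X ⊂ Y → ¬ Y ⊆ X
⊂⇒⊉ (_ , x , x∈Y , x∉X) Y⊆X = x∉X (Y⊆X x∈Y)

⊆-⊄⇒⊇ : ∀ {X Y : Subset n} → X ⊆ Y → ¬ X ⊂ Y → Y ⊆ X
⊆-⊄⇒⊇ {X = X} X⊆Y X⊄Y {x} x∈Y = decidable-stable (x ∈? X) (λ x∉X → X⊄Y (X⊆Y , x , x∈Y , x∉X))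

Minimal : ∀ {ℓ} → Pred (Subset n) ℓ → Subset n → Set ℓ
Minimal P Y = P Y × (∀ Z → P Z → Z ⊆ Y → Y ⊆ Z)

∃-minimal⊆ : ∀ {ℓ} {P : Pred (Subset n) ℓ} → Decidable P →
             ∀ {X} → P X → ∃[ Y ] (Y ⊆ X × Minimal P Y)
∃-minimal⊆ {P = P} P? = go (⊂-wellFounded _)
  where
  go : ∀ {X} → Acc _⊂_ X → P X → ∃[ Y ] (Y ⊆ X × Minimal P Y)
  go {X} (acc below) PX with anySubset? (λ Z → P? Z ×-dec Z ⊂? X)
  ... | yes (Z , PZ , Z⊂X) =
    let Y , Y⊆Z , minimal = go (below Z⊂X) PZ in Y , ⊆-trans Y⊆Z (p⊂q⇒p⊆q Z⊂X) , minimal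
  ... | no ∄Z = X , ⊆-refl , PX , λ Z PZ Z⊆X → ⊆-⊄⇒⊇ Z⊆X (λ Z⊂X → ∄Z (Z , PZ , Z⊂X))

anyFin-false : (p : Fin k → Bool) → (∀ i → p i ≡ false) → anyFin p ≡ false
anyFin-false {zero}  p p≡false = refl
anyFin-false {suc k} p p≡false rewrite p≡false zero = anyFin-false (p ∘ suc) (p≡false ∘ suc)

anyFin-∧-≟ : (p : Fin k → Bool) (e : Fin k) → anyFin (λ i → p i ∧ does (i ≟ e)) ≡ p e
anyFin-∧-≟ p zero
  rewrite ∧-identityʳ (p zero) | anyFin-false _ (λ i → ∧-zeroʳ (p (suc i))) = ∨-identityʳ (p zero)
anyFin-∧-≟ p (suc e) rewrite ∧-zeroʳ (p zero) = anyFin-∧-≟ (p ∘ suc) e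

image-id : (X : Subset n) → image (λ i → i) X ≡ X
image-id X = trans (Vec.tabulate-cong (anyFin-∧-≟ (lookup X))) (Vec.tabulate∘lookup X)

≅-from-⇔ : ∀ {M : Matroid n} {N : Subset n → Set} → (∀ X → Indep M X ⇔ N X) → M ≅ N
≅-from-⇔ {M = M} {N} M⇔N = Perm.id , λ X → subst (λ Y → Indep M X ⇔ N Y) (sym (image-id X)) (M⇔N X)

module _ {n} (M : Matroid n) where

  minimal-dependent⇒circuit : ∀ {C} → Minimal (Dependent M) C → Circuit M C
  minimal-dependent⇒circuit (dep , minimal) =
    dep , λ Y Y⊂C → decidable-stable (Indep-dec M Y) (λ depY → ⊂⇒⊉ Y⊂C (minimal Y depY (p⊂q⇒p⊆q Y⊂C)))

  dependent⇒∃circuit : ∀ {X} → Dependent M X → ∃[ C ] (C ⊆ X × Circuit M C)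
  dependent⇒∃circuit dep =
    let C , C⊆X , minimal = ∃-minimal⊆ (¬? ∘ Indep-dec M) dep in C , C⊆X , minimal-dependent⇒circuit minimal

  simple⇒indep : Simple M → ∀ {X} → ∣ X ∣ ≤ 2 → Indep M X
  simple⇒indep simple {X} ∣X∣≤2 = decidable-stable (Indep-dec M X) λ dep →
    let C , C⊆X , circuit = dependent⇒∃circuit dep in
    n≮n 2 (≤-trans (simple C circuit) (≤-trans (p⊆q⇒∣p∣≤∣q∣ C⊆X) ∣X∣≤2))

  rank⇒dependent : ∀ {r} → HasRank M r → ∀ {X} → r < ∣ X ∣ → Dependent M X
  rank⇒dependent (_ , bound) r<∣X∣ indep = <⇒≱ r<∣X∣ (bound _ indep)

  indep⇔avoids : ∀ {ℓ} {𝒞 : Pred (Subset n) ℓ} → (∀ C → 𝒞 C → Dependent M C) →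
                 (∀ X → Indep M X ⊎ ∃[ C ] (𝒞 C × C ⊆ X)) →
                 ∀ X → Indep M X ⇔ (∀ C → 𝒞 C → ¬ C ⊆ X)
  indep⇔avoids {𝒞 = 𝒞} 𝒞-dependent cover X = mk⇔ indep⇒avoids avoids⇒indep
    where
    indep⇒avoids : Indep M X → ∀ C → 𝒞 C → ¬ C ⊆ X
    indep⇒avoids indep C C∈𝒞 C⊆X = 𝒞-dependent C C∈𝒞 (I2 M C⊆X indep)

    avoids⇒indep : (∀ C → 𝒞 C → ¬ C ⊆ X) → Indep M X
    avoids⇒indep avoids with cover X
    ... | inj₁ indep            = indep
    ... | inj₂ (C , C∈𝒞 , C⊆X) = ⊥-elim (avoids C C∈𝒞 C⊆X)

-- Tables of known facts

data Table : ℕ → Set where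
  leaf : Maybe Bool → Table zero
  node : Table n → Table n → Table (suc n)

find : Table n → Subset n → Maybe Bool
find (leaf v)   []            = v
find (node l r) (outside ∷ X) = find l X
find (node l r) (inside ∷ X)  = find r X

store : Table n → Subset n → Bool → Table n
store (leaf v)   []            b = leaf (just b)
store (node l r) (outside ∷ X) b = node (store l X b) r
store (node l r) (inside ∷ X)  b = node l (store r X b)

build : (Subset n → Maybe Bool) → Table n
build {zero}  f = leaf (f [])
build {suc n} f = node (build (f ∘ (outside ∷_))) (build (f ∘ (inside ∷_)))

find-build : (f : Subset n → Maybe Bool) (X : Subset n) → find (build f) X ≡ f X
find-build f []            = refl
find-build f (outside ∷ X) = find-build (f ∘ (outside ∷_)) X
find-build f (inside ∷ X)  = find-build (f ∘ (inside ∷_)) X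

find-store-≡ : (K : Table n) (X : Subset n) (b : Bool) → find (store K X b) X ≡ just b
find-store-≡ (leaf v)   []            b = refl
find-store-≡ (node l r) (outside ∷ X) b = find-store-≡ l X b
find-store-≡ (node l r) (inside ∷ X)  b = find-store-≡ r X b

find-store-≢ : (K : Table n) {X Y : Subset n} (b : Bool) → X ≢ Y → find (store K X b) Y ≡ find K Y
find-store-≢ (leaf v)   {[]}          {[]}          b X≢Y = ⊥-elim (X≢Y refl)
find-store-≢ (node l r) {outside ∷ X} {outside ∷ Y} b X≢Y = find-store-≢ l b (X≢Y ∘ cong (outside ∷_))
find-store-≢ (node l r) {outside ∷ X} {inside ∷ Y}  b X≢Y = refl
find-store-≢ (node l r) {inside ∷ X}  {outside ∷ Y} b X≢Y = refl
find-store-≢ (node l r) {inside ∷ X}  {inside ∷ Y}  b X≢Y = find-store-≢ r b (X≢Y ∘ cong (inside ∷_))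

Known : Table n → Subset n → Bool → Set
Known K X b = find K X ≡ just b

known? : (K : Table n) (X : Subset n) (b : Bool) → Dec (Known K X b)
known? K X b = Maybe.≡-dec _≟ᵇ_ (find K X) (just b)

Fact : Matroid n → Subset n → Bool → Set
Fact M X true  = Indep M X
Fact M X false = Dependent M X

Fact-not : ∀ {M : Matroid n} {X} b → Fact M X b → ¬ Fact M X (not b)
Fact-not true  indep dep = dep indep
Fact-not false dep indep = dep indep

fact-does⇔ : ∀ {M : Matroid n} {Y} {P : Set} (P? : Dec P) → Fact M Y (does P?) → P ⇔ Indep M Y
fact-does⇔ (yes p) indep = mk⇔ (const indep) (const p)
fact-does⇔ (no ¬p) dep   = mk⇔ (⊥-elim ∘ ¬p) (⊥-elim ∘ dep)

infix 4 _⊨_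
record _⊨_ (M : Matroid n) (K : Table n) : Set where
  constructor valid
  field fact : ∀ X b → Known K X b → Fact M X b
open _⊨_

⊨-build : ∀ {M : Matroid n} {f} → (∀ X b → f X ≡ just b → Fact M X b) → M ⊨ build f
⊨-build {f = f} f-sound = valid λ X b eq → f-sound X b (trans (sym (find-build f X)) eq)

⊨-store : ∀ {M : Matroid n} {K X b} → M ⊨ K → Fact M X b → M ⊨ store K X b
⊨-store {M = M} {K} {X} {b} ⊨K X-fact = valid sound
  where
  sound : ∀ Y b′ → Known (store K X b) Y b′ → Fact M Y b′
  sound Y b′ eq with X ≟ₛ Y
  ... | yes refl with refl ← trans (sym (find-store-≡ K X b)) eq = X-fact
  ... | no X≢Y = fact ⊨K Y b′ (trans (sym (find-store-≢ K b X≢Y)) eq)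

axioms : ℕ → List (Subset n) → Subset n → Maybe Bool
axioms r Ds X with ∣ X ∣ ≤? 2 | r <? ∣ X ∣ ⊎-dec any? (X ≟ₛ_) Ds
... | yes _ | _     = just true
... | no _  | yes _ = just false
... | no _  | no _  = nothing

⊨-axioms : ∀ {M : Matroid n} {r Ds} → Simple M → HasRank M r → All (Dependent M) Ds →
           M ⊨ build (axioms r Ds)
⊨-axioms {M = M} {r} {Ds} simple rank Ds-dependent = ⊨-build sound
  where
  sound : ∀ X b → axioms r Ds X ≡ just b → Fact M X b
  sound X b eq with ∣ X ∣ ≤? 2 | r <? ∣ X ∣ ⊎-dec any? (X ≟ₛ_) Ds
  sound X true  eq | yes ∣X∣≤2 | _                 = simple⇒indep M simple ∣X∣≤2
  sound X false eq | no _      | yes (inj₁ r<∣X∣) = rank⇒dependent M rank r<∣X∣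
  sound X false eq | no _      | yes (inj₂ X∈Ds)  = All.lookup Ds-dependent X∈Ds

-- Derivations

data Step (n : ℕ) : Set where
  shrink grow : (X Y : Subset n) → Step n
  augment     : (X Y : Subset n) → Fin n → Step n

conclusion : Step n → Subset n × Bool
conclusion (shrink X _)    = X , true
conclusion (grow X _)      = X , false
conclusion (augment X _ e) = X ∪ ⁅ e ⁆ , true

-- A step whose conclusion contradicts the table closes its branch; `clash` marks the end of
-- such a branch and is never accepted on its own.  `extend X` has one branch per element that
-- (I3) against a basis may add to X, with `nothing` at the elements of X.
infixr 4 _▸_
data Derivation (Claim : Set) (n : ℕ) : Set where
  _▸_      : Step n → Derivation Claim n → Derivation Claim n
  exhaust  : (X Y : Subset n) → Derivation Claim n
  split    : Subset n → (if-independent if-dependent : Derivation Claim n) → Derivation Claim n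
  extend   : Subset n → Vec (Maybe (Derivation Claim n)) n → Derivation Claim n
  conclude : Claim → Derivation Claim n
  clash    : Derivation Claim n

Exchangeable : Table n → (X Y : Subset n) → Set
Exchangeable K X Y = Known K X true × Known K Y true × ∣ X ∣ < ∣ Y ∣

exchangeable? : (K : Table n) (X Y : Subset n) → Dec (Exchangeable K X Y)
exchangeable? K X Y = known? K X true ×-dec known? K Y true ×-dec ∣ X ∣ <? ∣ Y ∣

Excluded : Table n → (X Y : Subset n) → Fin n → Set
Excluded K X Y i = i ∉ Y ⊎ i ∈ X ⊎ Known K (X ∪ ⁅ i ⁆) false

excluded? : (K : Table n) (X Y : Subset n) (i : Fin n) → Dec (Excluded K X Y i)
excluded? K X Y i = ¬? (i ∈? Y) ⊎-dec i ∈? X ⊎-dec known? K (X ∪ ⁅ i ⁆) false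

Justified : Table n → Step n → Set
Justified K (shrink X Y)    = X ⊆ Y × Known K Y true
Justified K (grow X Y)      = Y ⊆ X × Known K Y false
Justified K (augment X Y e) = Exchangeable K X Y × (∀ i → i ≡ e ⊎ Excluded K X Y i)

justified? : (K : Table n) (s : Step n) → Dec (Justified K s)
justified? K (shrink X Y)    = X ⊆? Y ×-dec known? K Y true
justified? K (grow X Y)      = Y ⊆? X ×-dec known? K Y false
justified? K (augment X Y e) = exchangeable? K X Y ×-dec all? (λ i → i ≟ e ⊎-dec excluded? K X Y i)

module Checker {n} (r : ℕ) {Claim : Set} (Holds : Claim → Table n → Set) where

  Closes   : Table n → Derivation Claim n → Set
  Continue : Table n → Subset n × Bool → Derivation Claim n → Set
  Branches : ∀ {m} → Table n → Subset n → (Fin m → Fin n) → Vec (Maybe (Derivation Claim n)) m → Set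

  Continue K (X , b) d = if does (known? K X (not b)) then ⊤ else Closes (store K X b) d

  Closes K (s ▸ d)         = Justified K s × Continue K (conclusion s) d
  Closes K (exhaust X Y)   = Exchangeable K X Y × (∀ i → Excluded K X Y i)
  Closes K (split X d₁ d₂) = Continue K (X , true) d₁ × Continue K (X , false) d₂
  Closes K (extend X ds)   = (Known K X true × ∣ X ∣ < r) × Branches K X (λ i → i) ds
  Closes K (conclude c)    = Holds c K
  Closes K clash           = Empty

  Branches K X at []             = ⊤
  Branches K X at (nothing ∷ ds) = at zero ∈ X × Branches K X (at ∘ suc) ds
  Branches K X at (just d ∷ ds)  = Continue K (X ∪ ⁅ at zero ⁆ , true) d × Branches K X (at ∘ suc) ds

  module _ (holds? : ∀ c K → Dec (Holds c K)) where

    closes?   : ∀ K d → Dec (Closes K d)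
    continue? : ∀ K Xb d → Dec (Continue K Xb d)
    branches? : ∀ {m} K X at ds → Dec (Branches {m} K X at ds)

    continue? K (X , b) d with does (known? K X (not b))
    ... | true  = yes _
    ... | false = closes? (store K X b) d

    closes? K (s ▸ d)         = justified? K s ×-dec continue? K (conclusion s) d
    closes? K (exhaust X Y)   = exchangeable? K X Y ×-dec all? (excluded? K X Y)
    closes? K (split X d₁ d₂) = continue? K (X , true) d₁ ×-dec continue? K (X , false) d₂
    closes? K (extend X ds)   = (known? K X true ×-dec ∣ X ∣ <? r) ×-dec branches? K X (λ i → i) ds
    closes? K (conclude c)    = holds? c K
    closes? K clash           = no λ ()

    branches? K X at []             = yes _
    branches? K X at (nothing ∷ ds) = at zero ∈? X ×-dec branches? K X (at ∘ suc) ds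
    branches? K X at (just d ∷ ds)  = continue? K (X ∪ ⁅ at zero ⁆ , true) d ×-dec branches? K X (at ∘ suc) ds

module Soundness {n} (M : Matroid n) {r} (basis : ∃[ W ] (Indep M W × ∣ W ∣ ≡ r))
                 {Claim : Set} (Holds : Claim → Table n → Set)
                 {G : Set} (claim-sound : ∀ {c K} → M ⊨ K → Holds c K → G) where

  open Checker r Holds

  exchange : ∀ {K X Y} → M ⊨ K → Exchangeable K X Y → ∃[ i ] (i ∈ Y × i ∉ X × Indep M (X ∪ ⁅ i ⁆))
  exchange ⊨K (X-indep , Y-indep , ∣X∣<∣Y∣) = I3 M (fact ⊨K _ _ X-indep) (fact ⊨K _ _ Y-indep) ∣X∣<∣Y∣

  not-excluded : ∀ {K X Y i} → M ⊨ K → i ∈ Y → i ∉ X → Indep M (X ∪ ⁅ i ⁆) → ¬ Excluded K X Y i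
  not-excluded ⊨K i∈Y i∉X indep (inj₁ i∉Y)        = i∉Y i∈Y
  not-excluded ⊨K i∈Y i∉X indep (inj₂ (inj₁ i∈X)) = i∉X i∈X
  not-excluded ⊨K i∈Y i∉X indep (inj₂ (inj₂ dep)) = fact ⊨K _ _ dep indep

  extension : ∀ {X} → Indep M X → ∣ X ∣ < r → ∃[ i ] (i ∉ X × Indep M (X ∪ ⁅ i ⁆))
  extension {X} X-indep ∣X∣<r =
    let W , W-indep , ∣W∣≡r = basis
        i , _ , i∉X , indep = I3 M X-indep W-indep (subst (∣ X ∣ <_) (sym ∣W∣≡r) ∣X∣<r)
    in i , i∉X , indep

  step-sound : ∀ {K} s → M ⊨ K → Justified K s → uncurry (Fact M) (conclusion s)
  step-sound (shrink X Y) ⊨K (X⊆Y , Y-indep) = I2 M X⊆Y (fact ⊨K Y true Y-indep)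
  step-sound (grow X Y)   ⊨K (Y⊆X , Y-dep)   = λ X-indep → fact ⊨K Y false Y-dep (I2 M Y⊆X X-indep)
  step-sound (augment X Y e) ⊨K (exch , only-e) with exchange ⊨K exch
  ... | i , i∈Y , i∉X , indep with only-e i
  ...   | inj₁ refl = indep
  ...   | inj₂ excl = ⊥-elim (not-excluded ⊨K i∈Y i∉X indep excl)

  closes-sound   : ∀ {K} d → M ⊨ K → Closes K d → G
  continue-sound : ∀ {K} Xb d → M ⊨ K → uncurry (Fact M) Xb → Continue K Xb d → G
  branches-sound : ∀ {m K X at} ds → M ⊨ K → Branches {m} K X at ds →
                   ∀ j → at j ∉ X → Indep M (X ∪ ⁅ at j ⁆) → G

  continue-sound {K} (X , b) d ⊨K X-fact =
    closes-sound d (⊨-store ⊨K X-fact) ∘ subst (λ c → if c then ⊤ else Closes (store K X b) d) no-clash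
    where
    no-clash : does (known? K X (not b)) ≡ false
    no-clash = dec-false (known? K X (not b)) (Fact-not b X-fact ∘ fact ⊨K X (not b))

  closes-sound (s ▸ d) ⊨K (justified , next) =
    continue-sound (conclusion s) d ⊨K (step-sound s ⊨K justified) next
  closes-sound (exhaust X Y) ⊨K (exch , all-excluded) with exchange ⊨K exch
  ... | i , i∈Y , i∉X , indep = ⊥-elim (not-excluded ⊨K i∈Y i∉X indep (all-excluded i))
  closes-sound (split X d₁ d₂) ⊨K (next₁ , next₂) with Indep-dec M X
  ... | yes indep = continue-sound (X , true) d₁ ⊨K indep next₁
  ... | no dep    = continue-sound (X , false) d₂ ⊨K dep next₂
  closes-sound (extend X ds) ⊨K ((X-indep , ∣X∣<r) , branches)
    with extension (fact ⊨K X true X-indep) ∣X∣<r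
  ... | i , i∉X , indep = branches-sound ds ⊨K branches i i∉X indep
  closes-sound (conclude c) ⊨K holds = claim-sound ⊨K holds

  branches-sound (nothing ∷ ds) ⊨K (at₀∈X , _) zero at₀∉X _ = ⊥-elim (at₀∉X at₀∈X)
  branches-sound {X = X} {at} (just d ∷ ds) ⊨K (next , _) zero _ indep =
    continue-sound (X ∪ ⁅ at zero ⁆ , true) d ⊨K indep next
  branches-sound (nothing ∷ ds) ⊨K (_ , rest) (suc j) = branches-sound ds ⊨K rest j
  branches-sound (just _ ∷ ds)  ⊨K (_ , rest) (suc j) = branches-sound ds ⊨K rest j

-- Recognising minors and M*(K₃,₃)

MinorTable : {N : Subset k → Set} → Table n → Decidable N → (Fin k → Fin n) → Subset n → Set
MinorTable K N? f C =
  Injective _≡_ _≡_ f × (∀ i → f i ∉ C) × (∀ X → Known K (image f X ∪ C) (does (N? X)))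

minorTable? : {N : Subset k → Set} (K : Table n) (N? : Decidable N) (f : Fin k → Fin n) (C : Subset n) →
              Dec (MinorTable K N? f C)
minorTable? K N? f C =
  injective? f ×-dec all? (λ i → ¬? (f i ∈? C)) ×-dec
  ∀-subset? (λ X → known? K (image f X ∪ C) (does (N? X)))

minorTable-sound : ∀ {M : Matroid n} {K} {N : Subset k → Set} (N? : Decidable N) f C →
                   M ⊨ K → N ∅ → MinorTable K N? f C → HasMinor M N
minorTable-sound {M = M} N? f C ⊨K N∅ (f-injective , f∉C , table) =
  f , f-injective , C , f∉C , C , ⊆-refl , C-indep , (λ _ e∈C e∉C → ⊥-elim (e∉C e∈C)) , N⇔
  where
  N⇔ : ∀ X → _ ⇔ Indep M (image f X ∪ C)
  N⇔ X = fact-does⇔ (N? X) (fact ⊨K _ _ (table X))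

  C-indep : Indep M C
  C-indep = I2 M (q⊆p∪q (image f ∅) C) (Equivalence.to (N⇔ ∅) N∅)

NonemptyCut : Subset 9 → Set
NonemptyCut C = IsEdgeCut C × Nonempty C

isEdgeCut? : Decidable IsEdgeCut
isEdgeCut? C = anySubset? λ A → anySubset? λ B → C ≟ₛ edgeCut A B

bond⊆nonemptyCut : ∀ {C} → NonemptyCut C → ∃[ Y ] (Y ⊆ C × IsBond Y)
bond⊆nonemptyCut cut =
  let Y , Y⊆C , (Y-cut , Y-nonempty) , minimal = ∃-minimal⊆ (λ C → isEdgeCut? C ×-dec nonempty? C) cut
  in Y , Y⊆C , Y-cut , Y-nonempty , λ Z Z-cut Z-nonempty → minimal Z (Z-cut , Z-nonempty)

K33-bond-Indep⇔avoids : ∀ X → K33-bond-Indep X ⇔ (∀ C → NonemptyCut C → ¬ C ⊆ X)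
K33-bond-Indep⇔avoids X = mk⇔ no-bond⇒avoids avoids⇒no-bond
  where
  no-bond⇒avoids : K33-bond-Indep X → ∀ C → NonemptyCut C → ¬ C ⊆ X
  no-bond⇒avoids no-bond C cut C⊆X =
    let Y , Y⊆C , bond = bond⊆nonemptyCut cut in no-bond (Y , bond , ⊆-trans Y⊆C C⊆X)

  avoids⇒no-bond : (∀ C → NonemptyCut C → ¬ C ⊆ X) → K33-bond-Indep X
  avoids⇒no-bond avoids (Y , (Y-cut , Y-nonempty , _) , Y⊆X) = avoids Y (Y-cut , Y-nonempty) Y⊆X

BondTable : Table 9 → Set
BondTable K = (∀ A B → Nonempty (edgeCut A B) → Known K (edgeCut A B) false)
            × (∀ X → Known K X true ⊎ ∃[ A ] ∃[ B ] (Nonempty (edgeCut A B) × edgeCut A B ⊆ X))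

bondTable? : (K : Table 9) → Dec (BondTable K)
bondTable? K =
  ∀-subset? (λ A → ∀-subset? λ B → nonempty? (edgeCut A B) →-dec known? K (edgeCut A B) false) ×-dec
  ∀-subset? (λ X → known? K X true ⊎-dec
                   anySubset? λ A → anySubset? λ B → nonempty? (edgeCut A B) ×-dec edgeCut A B ⊆? X)

bondTable-sound : ∀ {M K} → M ⊨ K → BondTable K → M ≅ K33-bond-Indep
bondTable-sound {M = M} ⊨K (cuts-dependent , cover) =
  ≅-from-⇔ {M = M} λ X → ⇔-sym (K33-bond-Indep⇔avoids X) ⇔-∘ indep⇔avoids M cut-dependent cover′ X
  where
  cut-dependent : ∀ C → NonemptyCut C → Dependent M C
  cut-dependent _ ((A , B , refl) , nonempty) = fact ⊨K _ false (cuts-dependent A B nonempty)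

  cover′ : ∀ X → Indep M X ⊎ ∃[ C ] (NonemptyCut C × C ⊆ X)
  cover′ X with cover X
  ... | inj₁ indep                      = inj₁ (fact ⊨K X true indep)
  ... | inj₂ (A , B , nonempty , cut⊆X) = inj₂ (edgeCut A B , ((A , B , refl) , nonempty) , cut⊆X)

P7-Indep? : Decidable P7-Indep
P7-Indep? X = ∣ X ∣ ≤? 3 ×-dec ¬? isLine?
  where
  open P7
  isLine? : Dec (IsLine X)
  isLine? = X ≟ₛ triple a b c ⊎-dec X ≟ₛ triple a e d ⊎-dec X ≟ₛ triple c g d ⊎-dec
            X ≟ₛ triple b f d ⊎-dec X ≟ₛ triple e f g

U25-Indep? : Decidable U25-Indep
U25-Indep? X = ∣ X ∣ ≤? 2

-- The certificate

-- The vector lists the elements of M playing the elements of the minor, for P₇ in the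
-- order a, b, …, g.
data Outcome : Set where
  bond-matroid-K33 : Outcome
  P7-minor         : Vec (Fin 9) 7 → Subset 9 → Outcome
  U25-minor        : Vec (Fin 9) 5 → Subset 9 → Outcome

Holds : Outcome → Table 9 → Set
Holds bond-matroid-K33 K = BondTable K
Holds (P7-minor v C)   K = MinorTable K P7-Indep? (lookup v) C
Holds (U25-minor v C)  K = MinorTable K U25-Indep? (lookup v) C

holds? : ∀ o K → Dec (Holds o K)
holds? bond-matroid-K33 K = bondTable? K
holds? (P7-minor v C)   K = minorTable? K P7-Indep? (lookup v) C
holds? (U25-minor v C)  K = minorTable? K U25-Indep? (lookup v) C

holds-sound : ∀ {M K o} → M ⊨ K → Holds o K →
              (M ≅ K33-bond-Indep) ⊎ (HasMinor M U25-Indep ⊎ HasMinor M P7-Indep)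
holds-sound {o = bond-matroid-K33} ⊨K table = inj₁ (bondTable-sound ⊨K table)
holds-sound {o = P7-minor v C}     ⊨K table =
  inj₂ (inj₂ (minorTable-sound P7-Indep? (lookup v) C ⊨K (from-yes (P7-Indep? ∅)) table))
holds-sound {o = U25-minor v C}    ⊨K table =
  inj₂ (inj₁ (minorTable-sound U25-Indep? (lookup v) C ⊨K (from-yes (U25-Indep? ∅)) table))

P7-in-M/x₂ P7-in-M/x₅ P7-in-M/x₈ U25-in-M/x₂x₅ : Outcome
P7-in-M/x₂    = P7-minor (x₄ ∷ x₅ ∷ x₆ ∷ x₁ ∷ x₇ ∷ x₈ ∷ x₉ ∷ []) ⁅ x₂ ⁆
P7-in-M/x₅    = P7-minor (x₁ ∷ x₂ ∷ x₃ ∷ x₄ ∷ x₇ ∷ x₈ ∷ x₉ ∷ []) ⁅ x₅ ⁆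
P7-in-M/x₈    = P7-minor (x₁ ∷ x₂ ∷ x₃ ∷ x₇ ∷ x₄ ∷ x₅ ∷ x₆ ∷ []) ⁅ x₈ ⁆
U25-in-M/x₂x₅ = U25-minor (x₁ ∷ x₄ ∷ x₇ ∷ x₈ ∷ x₉ ∷ []) (⁅ x₂ ⁆ ∪ ⁅ x₅ ⁆)

triangles : List (Subset 9)
triangles = triple x₁ x₂ x₃ ∷ triple x₄ x₅ x₆ ∷ triple x₇ x₈ x₉ ∷ triple x₁ x₄ x₇ ∷ triple x₃ x₆ x₉ ∷ []

binary : ∀ n → ℕ → Subset n
binary zero    _ = []
binary (suc n) k = (k % 2 ≡ᵇ 1) ∷ binary n (k / 2)

-- In the derivation a numeral k stands for the set of the x_{i+1} such that bit i of k is set;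
-- e.g. 27 is {x₁,x₂,x₄,x₅}.
instance
  subset-literal : Number (Subset n)
  subset-literal {n} = record { Constraint = const ⊤ ; fromNat = λ k → binary n k }

when-x₁x₂x₄x₅-dependent : Derivation Outcome 9
when-x₁x₂x₄x₅-dependent =
  grow 15 7 ▸ grow 23 7 ▸ grow 39 7 ▸ grow 71 7 ▸ grow 135 7 ▸ grow 263 7 ▸ grow 57 56 ▸ grow 58 56
  ▸ grow 60 56 ▸ grow 120 56 ▸ grow 75 73 ▸ grow 77 73 ▸ grow 89 73 ▸ grow 201 73 ▸ grow 329 73
  ▸ grow 293 292 ▸ grow 294 292 ▸ grow 356 292 ▸ grow 449 448 ▸ grow 450 448 ▸ grow 452 448
  ▸ grow 456 448 ▸ grow 480 448 ▸ extend 3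
    ( nothing
    ∷ nothing
    ∷ just (extend 7
              ( nothing
              ∷ nothing
              ∷ nothing
              ∷ just (exhaust 69 15)
              ∷ just (split 11
                        ( exhaust 7 43)
                        ( exhaust 7 45))
              ∷ just (exhaust 262 39)
              ∷ just (exhaust 13 71)
              ∷ just (split 11
                        ( exhaust 7 323)
                        ( exhaust 7 325))
              ∷ just (exhaust 38 263)
              ∷ []))
    ∷ just (augment 5 11 x₄ ▸ augment 65 11 x₂ ▸ augment 5 67 x₇ ▸ extend 11
              ( nothing
              ∷ nothing
              ∷ just (clash)
              ∷ nothing
              ∷ just (clash)
              ∷ just (shrink 42 43 ▸ augment 24 42 x₂ ▸ augment 26 43 x₁ ▸ clash)
              ∷ just (clash)
              ∷ just (shrink 137 139 ▸ augment 72 137 x₈ ▸ augment 13 139 x₈ ▸ augment 69 139 x₈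
                      ▸ shrink 196 197 ▸ augment 320 200 x₄ ▸ augment 320 196 x₃ ▸ augment 36 324 x₇
                      ▸ augment 328 141 x₃ ▸ shrink 268 332 ▸ augment 36 268 x₄ ▸ augment 100 332 x₄
                      ▸ augment 24 44 x₃ ▸ augment 28 108 x₇ ▸ augment 11 92 x₅ ▸ clash)
              ∷ just (shrink 259 267 ▸ augment 5 259 x₉ ▸ augment 13 267 x₉ ▸ shrink 268 269
                      ▸ augment 36 261 x₁ ▸ augment 36 268 x₄ ▸ augment 24 44 x₃ ▸ augment 37 267 x₄
                      ▸ augment 28 45 x₁ ▸ augment 11 29 x₅ ▸ clash)
              ∷ []))
    ∷ just (augment 5 19 x₅ ▸ extend 19
              ( nothing
              ∷ nothing
              ∷ just (clash)
              ∷ just (clash)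
              ∷ nothing
              ∷ just (shrink 50 51 ▸ augment 24 50 x₂ ▸ augment 26 51 x₁ ▸ clash)
              ∷ just (shrink 81 83 ▸ augment 9 81 x₅ ▸ augment 25 83 x₂ ▸ clash)
              ∷ just (shrink 131 147 ▸ augment 5 131 x₈ ▸ split 11
                        ( augment 5 11 x₄ ▸ augment 65 11 x₂ ▸ augment 5 67 x₇ ▸ split 27
                            ( clash)
                            ( augment 11 147 x₈ ▸ shrink 137 139 ▸ augment 65 137 x₈
                              ▸ augment 72 137 x₈ ▸ augment 133 139 x₄ ▸ augment 69 139 x₈
                              ▸ shrink 196 197 ▸ augment 320 193 x₁ ▸ augment 320 200 x₄
                              ▸ augment 320 196 x₃ ▸ augment 36 324 x₇ ▸ augment 321 141 x₃
                              ▸ augment 328 141 x₃ ▸ shrink 268 332 ▸ augment 36 268 x₄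
                              ▸ augment 100 325 x₁ ▸ augment 24 44 x₃ ▸ augment 13 101 x₆
                              ▸ augment 28 45 x₁ ▸ exhaust 19 29))
                        ( grow 43 11 ▸ augment 9 19 x₅ ▸ augment 9 131 x₈ ▸ augment 40 25 x₁
                          ▸ augment 65 137 x₈ ▸ augment 3 41 x₆ ▸ augment 320 193 x₁
                          ▸ augment 41 147 x₈ ▸ augment 5 35 x₆ ▸ augment 321 169 x₆
                          ▸ augment 37 353 x₇ ▸ shrink 69 101 ▸ augment 9 69 x₃ ▸ exhaust 3 13))
              ∷ just (shrink 259 275 ▸ augment 5 259 x₉ ▸ augment 21 275 x₉ ▸ shrink 276 277
                      ▸ augment 36 261 x₁ ▸ augment 36 276 x₅ ▸ augment 24 52 x₃ ▸ augment 37 275 x₅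
                      ▸ augment 28 53 x₁ ▸ augment 19 29 x₄ ▸ clash)
              ∷ []))
    ∷ just (augment 5 35 x₆ ▸ augment 260 37 x₁ ▸ augment 288 37 x₁ ▸ extend 35
              ( nothing
              ∷ nothing
              ∷ just (clash)
              ∷ just (shrink 42 43 ▸ augment 24 42 x₂ ▸ augment 26 43 x₁ ▸ clash)
              ∷ just (shrink 50 51 ▸ augment 24 50 x₂ ▸ augment 26 51 x₁ ▸ clash)
              ∷ nothing
              ∷ just (shrink 97 99 ▸ augment 9 97 x₆ ▸ augment 24 41 x₁ ▸ augment 25 99 x₂ ▸ clash)
              ∷ just (augment 37 163 x₈ ▸ augment 261 163 x₈ ▸ shrink 388 389 ▸ shrink 385 389
                      ▸ augment 192 385 x₁ ▸ augment 320 388 x₃ ▸ augment 289 165 x₈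
                      ▸ augment 193 417 x₆ ▸ augment 324 165 x₁ ▸ shrink 97 225 ▸ augment 9 97 x₆
                      ▸ augment 37 325 x₇ ▸ augment 24 41 x₁ ▸ augment 35 101 x₇ ▸ augment 25 99 x₂
                      ▸ clash)
              ∷ just (exhaust 37 291)
              ∷ []))
    ∷ just (augment 5 67 x₇ ▸ augment 6 67 x₇ ▸ augment 9 67 x₂ ▸ augment 5 11 x₄ ▸ extend 67
              ( nothing
              ∷ nothing
              ∷ just (clash)
              ∷ just (clash)
              ∷ just (augment 11 83 x₅ ▸ clash)
              ∷ just (shrink 97 99 ▸ augment 9 97 x₆ ▸ augment 24 41 x₁ ▸ augment 25 99 x₂ ▸ clash)
              ∷ nothing
              ∷ just (shrink 194 195 ▸ augment 320 194 x₂ ▸ augment 69 195 x₈ ▸ augment 70 195 x₈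
                      ▸ shrink 196 197 ▸ augment 320 196 x₃ ▸ augment 322 195 x₁
                      ▸ augment 322 198 x₃ ▸ shrink 262 326 ▸ augment 36 324 x₇ ▸ augment 36 262 x₂
                      ▸ augment 11 323 x₉ ▸ augment 100 326 x₂ ▸ augment 38 267 x₄ ▸ shrink 42 46
                      ▸ augment 24 42 x₂ ▸ augment 11 102 x₆ ▸ augment 26 43 x₁ ▸ clash)
              ∷ just (shrink 259 323 ▸ augment 5 259 x₉ ▸ augment 11 323 x₉ ▸ augment 13 323 x₉
                      ▸ shrink 268 269 ▸ augment 36 261 x₁ ▸ augment 36 268 x₄ ▸ augment 24 44 x₃
                      ▸ augment 37 267 x₄ ▸ augment 28 45 x₁ ▸ augment 11 29 x₅ ▸ clash)
              ∷ []))
    ∷ just (augment 5 131 x₈ ▸ augment 6 131 x₈ ▸ extend 131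
              ( nothing
              ∷ nothing
              ∷ just (clash)
              ∷ just (shrink 137 139 ▸ shrink 11 139 ▸ augment 65 137 x₈ ▸ augment 72 137 x₈
                      ▸ augment 133 139 x₄ ▸ augment 320 200 x₄ ▸ augment 193 141 x₃
                      ▸ shrink 196 197 ▸ augment 320 196 x₃ ▸ augment 328 141 x₃ ▸ shrink 268 332
                      ▸ augment 36 324 x₇ ▸ augment 36 268 x₄ ▸ augment 24 44 x₃
                      ▸ augment 100 332 x₄ ▸ augment 28 108 x₇ ▸ augment 11 92 x₅ ▸ clash)
              ∷ just (shrink 19 147 ▸ split 11
                        ( augment 5 11 x₄ ▸ augment 65 11 x₂ ▸ augment 5 67 x₇ ▸ split 27
                            ( clash)
                            ( augment 11 147 x₈ ▸ shrink 137 139 ▸ augment 65 137 x₈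
                              ▸ augment 72 137 x₈ ▸ augment 133 139 x₄ ▸ augment 69 139 x₈
                              ▸ shrink 196 197 ▸ augment 320 193 x₁ ▸ augment 320 200 x₄
                              ▸ augment 320 196 x₃ ▸ augment 36 324 x₇ ▸ augment 321 141 x₃
                              ▸ augment 328 141 x₃ ▸ shrink 268 332 ▸ augment 36 268 x₄
                              ▸ augment 100 325 x₁ ▸ augment 24 44 x₃ ▸ augment 13 101 x₆
                              ▸ augment 28 45 x₁ ▸ exhaust 19 29))
                        ( grow 43 11 ▸ augment 9 131 x₈ ▸ augment 9 19 x₅ ▸ augment 40 25 x₁
                          ▸ augment 65 137 x₈ ▸ augment 3 41 x₆ ▸ augment 320 193 x₁
                          ▸ augment 41 147 x₈ ▸ augment 5 35 x₆ ▸ augment 321 169 x₆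
                          ▸ augment 37 353 x₇ ▸ shrink 69 101 ▸ augment 9 69 x₃ ▸ exhaust 3 13))
              ∷ just (shrink 35 163 ▸ augment 5 35 x₆ ▸ augment 133 163 x₆ ▸ shrink 164 165
                      ▸ augment 260 164 x₈ ▸ augment 288 37 x₁ ▸ augment 288 164 x₈
                      ▸ augment 192 416 x₆ ▸ augment 320 388 x₃ ▸ augment 289 165 x₈
                      ▸ augment 224 417 x₁ ▸ augment 324 165 x₁ ▸ shrink 97 225 ▸ augment 9 97 x₆
                      ▸ augment 37 325 x₇ ▸ augment 24 41 x₁ ▸ augment 35 101 x₇ ▸ augment 25 99 x₂
                      ▸ clash)
              ∷ just (shrink 194 195 ▸ shrink 67 195 ▸ augment 9 67 x₂ ▸ augment 320 194 x₂
                      ▸ augment 133 195 x₇ ▸ augment 134 195 x₇ ▸ shrink 196 197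
                      ▸ augment 320 196 x₃ ▸ augment 322 195 x₁ ▸ augment 322 198 x₃
                      ▸ shrink 262 326 ▸ augment 36 324 x₇ ▸ augment 36 262 x₂ ▸ augment 11 323 x₉
                      ▸ augment 100 326 x₂ ▸ augment 38 267 x₄ ▸ shrink 42 46 ▸ augment 24 42 x₂
                      ▸ augment 11 102 x₆ ▸ augment 26 43 x₁ ▸ clash)
              ∷ nothing
              ∷ just (shrink 386 387 ▸ shrink 259 387 ▸ augment 5 259 x₉ ▸ augment 192 386 x₂
                      ▸ augment 320 386 x₂ ▸ augment 36 261 x₁ ▸ augment 194 387 x₁
                      ▸ augment 322 387 x₁ ▸ shrink 67 195 ▸ augment 37 323 x₇ ▸ shrink 97 101
                      ▸ augment 9 97 x₆ ▸ augment 67 101 x₆ ▸ augment 24 41 x₁ ▸ augment 25 99 x₂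
                      ▸ clash)
              ∷ []))
    ∷ just (augment 5 259 x₉ ▸ augment 36 261 x₁ ▸ augment 288 261 x₁ ▸ augment 3 37 x₆ ▸ extend 259
              ( nothing
              ∷ nothing
              ∷ just (clash)
              ∷ just (augment 37 267 x₄ ▸ shrink 41 45 ▸ augment 24 41 x₁ ▸ augment 35 45 x₄
                      ▸ augment 25 43 x₂ ▸ clash)
              ∷ just (augment 37 275 x₅ ▸ shrink 49 53 ▸ augment 24 49 x₁ ▸ augment 35 53 x₅
                      ▸ augment 25 51 x₂ ▸ clash)
              ∷ just (exhaust 261 291)
              ∷ just (augment 37 323 x₇ ▸ shrink 97 101 ▸ augment 9 97 x₆ ▸ augment 35 101 x₇
                      ▸ augment 24 41 x₁ ▸ augment 25 99 x₂ ▸ clash)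
              ∷ just (shrink 386 387 ▸ shrink 385 387 ▸ augment 192 386 x₂ ▸ augment 192 385 x₁
                      ▸ augment 320 386 x₂ ▸ augment 261 387 x₈ ▸ augment 72 193 x₈
                      ▸ augment 289 389 x₈ ▸ augment 194 387 x₁ ▸ augment 322 387 x₁ ▸ shrink 67 195
                      ▸ augment 9 67 x₂ ▸ augment 37 323 x₇ ▸ augment 200 417 x₆ ▸ shrink 104 232
                      ▸ augment 24 104 x₇ ▸ augment 88 101 x₃ ▸ augment 11 92 x₅ ▸ clash)
              ∷ nothing
              ∷ []))
    ∷ [])
  where open FromNat using (fromNat)

when-x₁x₂x₄x₅-independent : Derivation Outcome 9
when-x₁x₂x₄x₅-independent =
  grow 15 7 ▸ grow 23 7 ▸ grow 39 7 ▸ grow 71 7 ▸ grow 135 7 ▸ grow 263 7 ▸ grow 57 56 ▸ grow 58 56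
  ▸ grow 60 56 ▸ grow 120 56 ▸ grow 184 56 ▸ grow 312 56 ▸ grow 75 73 ▸ grow 77 73 ▸ grow 89 73
  ▸ grow 105 73 ▸ grow 201 73 ▸ grow 329 73 ▸ grow 293 292 ▸ grow 294 292 ▸ grow 300 292
  ▸ grow 308 292 ▸ grow 356 292 ▸ grow 420 292 ▸ grow 449 448 ▸ grow 450 448 ▸ grow 452 448
  ▸ grow 456 448 ▸ grow 464 448 ▸ grow 480 448 ▸ shrink 26 27 ▸ shrink 25 27 ▸ shrink 19 27
  ▸ shrink 11 27 ▸ augment 5 19 x₅ ▸ augment 5 11 x₄ ▸ augment 6 19 x₅ ▸ augment 6 11 x₄
  ▸ augment 40 26 x₂ ▸ augment 40 25 x₁ ▸ augment 48 26 x₂ ▸ augment 48 25 x₁ ▸ augment 65 25 x₅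
  ▸ augment 65 11 x₂ ▸ augment 72 25 x₅ ▸ augment 72 11 x₂ ▸ augment 5 67 x₇ ▸ augment 6 67 x₇
  ▸ augment 40 88 x₇ ▸ augment 48 88 x₇ ▸ augment 65 41 x₆ ▸ augment 72 13 x₃ ▸ augment 21 27 x₄
  ▸ augment 22 27 x₄ ▸ augment 42 27 x₁ ▸ augment 50 27 x₁ ▸ augment 81 27 x₂ ▸ augment 88 27 x₂
  ▸ shrink 28 29 ▸ shrink 35 43 ▸ shrink 82 83 ▸ augment 5 35 x₆ ▸ augment 6 35 x₆
  ▸ augment 40 28 x₃ ▸ augment 48 28 x₃ ▸ augment 21 51 x₆ ▸ augment 21 83 x₇ ▸ augment 13 43 x₆
  ▸ augment 22 51 x₆ ▸ augment 22 83 x₇ ▸ augment 14 43 x₆ ▸ augment 42 90 x₇ ▸ augment 50 90 x₇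
  ▸ augment 67 43 x₆ ▸ augment 88 29 x₃ ▸ augment 69 43 x₆ ▸ augment 104 29 x₃ ▸ shrink 84 85
  ▸ shrink 98 106 ▸ shrink 100 101 ▸ augment 260 37 x₁ ▸ augment 260 38 x₂ ▸ augment 260 44 x₄
  ▸ augment 260 52 x₅ ▸ augment 260 100 x₇ ▸ augment 288 37 x₁ ▸ augment 288 38 x₂
  ▸ augment 288 44 x₄ ▸ augment 288 52 x₅ ▸ augment 288 100 x₇ ▸ augment 70 99 x₆
  ▸ augment 112 92 x₃ ▸ augment 3 261 x₉ ▸ augment 24 296 x₉ ▸ augment 192 324 x₃
  ▸ augment 192 352 x₆ ▸ augment 384 324 x₃ ▸ augment 384 352 x₆ ▸ augment 261 43 x₄
  ▸ augment 261 51 x₅ ▸ augment 261 99 x₇ ▸ augment 262 43 x₄ ▸ augment 262 51 x₅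
  ▸ augment 262 99 x₇ ▸ augment 268 108 x₇ ▸ augment 276 116 x₇ ▸ augment 289 53 x₅
  ▸ augment 289 45 x₄ ▸ augment 289 101 x₇ ▸ augment 290 54 x₅ ▸ augment 290 46 x₄
  ▸ augment 290 102 x₇ ▸ augment 296 92 x₇ ▸ augment 304 92 x₇ ▸ shrink 265 269 ▸ shrink 273 277
  ▸ shrink 321 325 ▸ shrink 266 270 ▸ shrink 274 278 ▸ shrink 322 326 ▸ shrink 328 332
  ▸ shrink 336 340 ▸ augment 36 388 x₈ ▸ augment 192 321 x₁ ▸ augment 192 322 x₂
  ▸ augment 192 328 x₄ ▸ augment 192 336 x₅ ▸ augment 384 321 x₁ ▸ augment 384 322 x₂
  ▸ augment 384 328 x₄ ▸ augment 384 336 x₅ ▸ augment 26 306 x₉ ▸ augment 25 305 x₉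
  ▸ augment 19 277 x₉ ▸ augment 11 269 x₉ ▸ augment 67 269 x₉ ▸ augment 88 305 x₉
  ▸ augment 196 325 x₁ ▸ augment 196 326 x₂ ▸ augment 196 332 x₄ ▸ augment 196 340 x₅
  ▸ augment 224 353 x₁ ▸ augment 224 354 x₂ ▸ augment 224 360 x₄ ▸ augment 224 368 x₅
  ▸ augment 388 101 x₁ ▸ augment 388 108 x₄ ▸ augment 388 102 x₂ ▸ augment 388 116 x₅
  ▸ augment 416 101 x₁ ▸ augment 416 108 x₄ ▸ augment 416 102 x₂ ▸ augment 416 116 x₅
  ▸ shrink 133 197 ▸ shrink 134 198 ▸ shrink 140 204 ▸ shrink 148 212 ▸ shrink 161 225
  ▸ shrink 162 226 ▸ shrink 168 232 ▸ shrink 176 240 ▸ augment 3 133 x₈ ▸ augment 9 193 x₈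
  ▸ augment 24 168 x₈ ▸ augment 25 225 x₈ ▸ augment 11 197 x₈ ▸ augment 13 197 x₈
  ▸ augment 41 225 x₈ ▸ augment 81 281 x₉ ▸ augment 67 197 x₈ ▸ augment 88 225 x₈
  ▸ augment 74 267 x₉ ▸ augment 37 389 x₈ ▸ augment 38 389 x₈ ▸ augment 44 396 x₈
  ▸ augment 52 396 x₈ ▸ augment 259 389 x₈ ▸ augment 280 424 x₈ ▸ augment 193 281 x₅
  ▸ augment 200 267 x₂ ▸ shrink 145 153 ▸ shrink 138 139 ▸ augment 14 139 x₈ ▸ augment 49 153 x₈
  ▸ augment 28 172 x₈ ▸ augment 35 165 x₈ ▸ augment 385 337 x₅ ▸ augment 386 330 x₄ ▸ split 78
    ( exhaust 11 78)
    ( split 113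
        ( exhaust 25 113)
        ( split 228
            ( exhaust 324 228)
            ( split 284
                ( exhaust 44 284)
                ( split 291
                    ( exhaust 37 291)
                    ( split 393
                        ( exhaust 321 393)
                        ( split 146
                            ( split 147
                                ( augment 21 147 x₈ ▸ augment 22 147 x₈ ▸ split 154
                                    ( augment 42 154 x₈ ▸ augment 50 154 x₈ ▸ split 210
                                        ( augment 322 210 x₅ ▸ augment 386 210 x₅
                                          ▸ conclude U25-in-M/x₂x₅)
                                        ( split 338
                                            ( exhaust 194 338)
                                            ( split 402
                                                ( exhaust 82 402)
                                                ( conclude P7-in-M/x₈))))
                                    ( augment 146 90 x₇ ▸ augment 146 282 x₉ ▸ augment 322 210 x₅
                                      ▸ split 170
                                        ( exhaust 26 170)
                                        ( split 178
                                            ( exhaust 26 178)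
                                            ( conclude P7-in-M/x₅))))
                                ( augment 146 27 x₄ ▸ augment 146 51 x₆ ▸ augment 146 83 x₇
                                  ▸ augment 146 275 x₉ ▸ augment 42 154 x₈ ▸ augment 322 210 x₅
                                  ▸ split 149
                                    ( exhaust 19 149)
                                    ( split 150
                                        ( exhaust 19 150)
                                        ( conclude P7-in-M/x₂))))
                            ( grow 147 146 ▸ grow 154 146 ▸ grow 210 146 ▸ split 149
                                ( exhaust 19 149)
                                ( split 170
                                    ( exhaust 26 170)
                                    ( split 338
                                        ( exhaust 194 338)
                                        ( conclude bond-matroid-K33))))))))))
  where open FromNat using (fromNat)

derivation : Derivation Outcome 9
derivation = split 27 when-x₁x₂x₄x₅-independent when-x₁x₂x₄x₅-dependent
  where open FromNat using (fromNat)

open Checker 4 Holds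

derivation-closes : Closes (build (axioms 4 triangles)) derivation
derivation-closes = from-yes (closes? holds? (build (axioms 4 triangles)) derivation)

lemma3p1 : (M : Matroid 9) → Simple M → HasRank M 4 →
    Triangle M (triple x₁ x₂ x₃) → Triangle M (triple x₄ x₅ x₆) →
    Triangle M (triple x₇ x₈ x₉) → Triangle M (triple x₁ x₄ x₇) →
    Triangle M (triple x₃ x₆ x₉) →
    (M ≅ K33-bond-Indep) ⊎ (HasMinor M U25-Indep ⊎ HasMinor M P7-Indep)
lemma3p1 M simple rank t₁ t₂ t₃ t₄ t₅ =
  Soundness.closes-sound M (proj₁ rank) Holds holds-sound derivation axioms-valid derivation-closes
  where
  dependent : ∀ {T} → Triangle M T → Dependent M T
  dependent = proj₁ ∘ proj₁

  -- Naming Ds keeps Agda from solving it by unfolding the table.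
  axioms-valid : M ⊨ build (axioms 4 triangles)
  axioms-valid = ⊨-axioms {Ds = triangles} simple rank
    (dependent t₁ All.∷ dependent t₂ All.∷ dependent t₃ All.∷ dependent t₄ All.∷ dependent t₅ All.∷ All.[])
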